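{- Let $D=(d_1,\ldots,d_n)$ be a forcibly bicyclic graphic sequence. If $D$ has a realization $G$ containing a theta graph $\Theta(r,s,t)$ as a subgraph, then there exists another realization $G'$ of $D$ containing a theta graph $\Theta(1,2,r+s+t-3)$ as a subgraph.
   Context: All graphs are simple. A realization of a sequence $D=(d_1,\ldots,d_n)$ is a simple graph with vertices $v_1,\ldots,v_n$ with $\deg(v_i)=d_i$; $D$ is graphic if it has a realization. A graphic sequence is forcibly bicyclic if every realization of it is connected and has exactly $n+1$ edges. $P_k$ denotes the path with $k+1$ vertices (length $k$). The theta graph $\Theta(r,s,t)$ is obtained from paths $P_r,P_s,P_t$ (of lengths $r,s,t$) by identifying one end vertex of each into a single vertex and identifying the other end vertices of each into another single vertex. -}

module Defs where

open import Data.Nat using (ℕ; zero; suc; _≤_; _+_)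
open import Data.Bool using (Bool; true; false; if_then_else_; _∧_)
open import Data.Fin using (Fin; _<?_)
open import Data.List using (List; []; _∷_; _++_; [_]; map; allFin)
open import Data.Nat.ListAction using (sum)
open import Data.Vec using (Vec; lookup; toList)
open import Data.Product using (Σ; _×_; ∃)
open import Data.Unit using (⊤)
open import Relation.Nullary using (¬_)
open import Relation.Nullary.Decidable using (⌊_⌋)
open import Relation.Binary.PropositionalEquality using (_≡_)
open import Relation.Binary.Construct.Closure.ReflexiveTransitive using (Star)
open import Data.List.Relation.Unary.Unique.Propositional using (Unique)

record Graph (n : ℕ) : Set where
  field
    adj    : Fin n → Fin n → Bool
    adj-sym : ∀ i j → adj i j ≡ adj j i
    adj-irr : ∀ i → adj i i ≡ false
open Graph public

Adj : ∀ {n} → Graph n → Fin n → Fin n → Set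
Adj G i j = adj G i j ≡ true

deg : ∀ {n} → Graph n → Fin n → ℕ
deg {n} G i = sum (map (λ j → if adj G i j then 1 else 0) (allFin n))

numEdges : ∀ {n} → Graph n → ℕ
numEdges {n} G =
  sum (map (λ i → sum (map (λ j → if adj G i j ∧ ⌊ i <? j ⌋ then 1 else 0) (allFin n))) (allFin n))

IsRealization : ∀ {n} → Graph n → Vec ℕ n → Set
IsRealization G D = ∀ i → deg G i ≡ lookup D i

Graphic : ∀ {n} → Vec ℕ n → Set
Graphic {n} D = Σ (Graph n) λ G → IsRealization G D

Connected : ∀ {n} → Graph n → Set
Connected G = ∀ i j → Star (Adj G) i j

ForciblyBicyclic : ∀ {n} → Vec ℕ n → Set
ForciblyBicyclic {n} D =
  Graphic D × (∀ (G : Graph n) → IsRealization G D → Connected G × numEdges G ≡ suc n)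

ConsecAdj : ∀ {n} → Graph n → List (Fin n) → Set
ConsecAdj G [] = ⊤
ConsecAdj G (x ∷ []) = ⊤
ConsecAdj G (x ∷ y ∷ xs) = Adj G x y × ConsecAdj G (y ∷ xs)

-- Θ(r,s,t) is a simple graph: all path lengths ≥ 1, at most one equal to 1
ValidTheta : ℕ → ℕ → ℕ → Set
ValidTheta r s t =
  1 ≤ r × 1 ≤ s × 1 ≤ t ×
  ¬ (r ≡ 1 × s ≡ 1) × ¬ (r ≡ 1 × t ≡ 1) × ¬ (s ≡ 1 × t ≡ 1)

-- G contains Θ(r,s,t) as a subgraph: distinct vertices u, v joined by three
-- paths u - p - v, u - q - v, u - w - v of lengths r, s, t whose vertices
-- are pairwise distinct (apart from the shared ends u, v).
ContainsTheta : ∀ {n} → Graph n → ℕ → ℕ → ℕ → Set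
ContainsTheta {n} G r s t =
  ValidTheta r s t ×
  Σ (Fin n) λ u → Σ (Fin n) λ v →
  Σ (Vec (Fin n) (r Data.Nat.∸ 1)) λ p →
  Σ (Vec (Fin n) (s Data.Nat.∸ 1)) λ q →
  Σ (Vec (Fin n) (t Data.Nat.∸ 1)) λ w →
    ConsecAdj G (u ∷ toList p ++ [ v ]) ×
    ConsecAdj G (u ∷ toList q ++ [ v ]) ×
    ConsecAdj G (u ∷ toList w ++ [ v ]) ×
    Unique (u ∷ v ∷ toList p ++ toList q ++ toList w)

module Submission where

-- Every realization of D is connected with n + 1 edges, so no vertex set S induces |S| + 2 edges
-- (cycle rank 3): extending S to all n vertices along edges leaving S adds at least one edge per
-- new vertex, which would give n + 2 edges.  Consequently the theta graph, with branch vertices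
-- u, v and path interiors p, q, w, has none of the four chords that would complete such an S,
-- and the corresponding degree-preserving 2-switches are available.  Replacing u a, v b by u v,
-- a b (a first on p, b last on w) turns (p, q, w) into ([], q, w ++ p); then replacing q₁ q₂, v b
-- by q₁ v, q₂ b turns ([], q₁ ∷ q₂ ∷ q, w) into ([], [q₁], w ++ q₂ ∷ q).  Both keep the number
-- of interior vertices, so the final theta is Θ(1, 2, r + s + t - 3).

open import Defs
open import Data.Bool using (Bool; true; false; if_then_else_; _∧_; _∨_)
open import Data.Bool.Properties using (∨-zeroʳ; ¬-not)
open import Data.Empty using (⊥-elim)
open import Data.Fin using (Fin; zero; suc)
open import Data.Fin.Properties using (_≟_; _<?_; <-cmp)
open import Data.List using (List; []; _∷_; [_]; _++_; _∷ʳ_; _ʳ++_; length; map; allFin; tabulate; initLast; _∷ʳ′_)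
open import Data.List.Properties using (map-tabulate; ++-assoc; ++-conicalˡ; ++-conicalʳ; length-++)
open import Data.List.Membership.Propositional using (_∈_; _∉_)
open import Data.List.Membership.Propositional.Properties using (∈-++⁺ˡ; ∈-++⁺ʳ; ∈-++⁻)
open import Data.List.Relation.Binary.Disjoint.Propositional using (Disjoint)
import Data.List.Relation.Binary.Disjoint.Propositional.Properties as Disjoint
open import Data.List.Relation.Unary.All as All using (All; []; _∷_)
open import Data.List.Relation.Unary.All.Properties using (¬Any⇒All¬)
open import Data.List.Relation.Unary.AllPairs using ([]; _∷_)
open import Data.List.Relation.Unary.Any using (here; there; any?)
import Data.List.Relation.Unary.Any.Properties as Any
open import Data.List.Relation.Unary.Unique.Propositional using (Unique)
open import Data.List.Relation.Unary.Unique.Propositional.Properties using (++⁺; drop⁺; Unique[x∷xs]⇒x∉xs)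
open import Data.Nat using (ℕ; zero; suc; _+_; _*_; _∸_; _≤_; _<_; z≤n; s≤s)
import Data.Nat.ListAction as List
open import Data.Nat.Properties hiding (_≟_; _<?_; <-cmp)
open import Data.Nat.Tactic.RingSolver using (solve-∀)
open import Algebra.Properties.Semiring.Sum +-*-semiring
  using (sum; sum-syntax; ∑-distrib-+; ∑-comm; *-distribˡ-sum; sum-cong-≗; sum-replicate-zero)
open import Data.Product using (Σ; ∃; _×_; _,_; proj₁; proj₂)
import Data.Product
open import Data.Sum using (_⊎_; inj₁; inj₂) renaming ([_,_] to either)
import Data.Sum
open import Data.Unit using (tt)
open import Data.Vec using (Vec; toList; fromList)
open import Data.Vec.Properties using (length-toList; toList∘fromList)
open import Function using (_∘_; case_of_; mk⇔)
open import Relation.Binary using (tri<; tri≈; tri>)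
open import Relation.Binary.Construct.Closure.ReflexiveTransitive using (Star; ε; _◅_)
open import Relation.Binary.PropositionalEquality hiding ([_])
open import Relation.Nullary using (¬_; Dec; does; yes; no)
open import Relation.Nullary.Decidable using (dec-true; dec-false; ⌊_⌋; isYes≗does; _×-dec_; _⊎-dec_; does-⇔; map′)

𝟙 : Bool → ℕ
𝟙 b = if b then 1 else 0

δ : ∀ {n} → Fin n → Fin n → ℕ
δ c i = 𝟙 (does (i ≟ c))

𝟙≤1 : ∀ b → 𝟙 b ≤ 1
𝟙≤1 true  = ≤-refl
𝟙≤1 false = z≤n

𝟙-∧ : ∀ x y → 𝟙 (x ∧ y) ≡ 𝟙 x * 𝟙 y
𝟙-∧ true  y = sym (+-identityʳ (𝟙 y))
𝟙-∧ false y = refl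

𝟙-⊎-dec : ∀ {a b} {A : Set a} {B : Set b} → ¬ (A × B) → (a? : Dec A) (b? : Dec B) →
  𝟙 (does (a? ⊎-dec b?)) ≡ 𝟙 (does a?) + 𝟙 (does b?)
𝟙-⊎-dec ¬a×b (yes a) (yes b) = ⊥-elim (¬a×b (a , b))
𝟙-⊎-dec ¬a×b (yes a) (no _)  = refl
𝟙-⊎-dec ¬a×b (no _)  b?      = refl

does-true⇒ : ∀ {a} {A : Set a} (a? : Dec A) → does a? ≡ true → A
does-true⇒ (yes a) _ = a

⌊⌋-true : ∀ {a} {A : Set a} (a? : Dec A) → A → ⌊ a? ⌋ ≡ true
⌊⌋-true a? x = trans (isYes≗does a?) (dec-true a? x)

∑-mono-≤ : ∀ {n} {f g : Fin n → ℕ} → (∀ i → f i ≤ g i) → ∑[ i < n ] f i ≤ ∑[ i < n ] g i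
∑-mono-≤ {zero}  f≤g = z≤n
∑-mono-≤ {suc n} f≤g = +-mono-≤ (f≤g zero) (∑-mono-≤ (f≤g ∘ suc))

∑-δ* : ∀ {n} (c : Fin n) (f : Fin n → ℕ) → ∑[ i < n ] (δ c i * f i) ≡ f c
∑-δ* {suc n} zero    f = trans (cong₂ _+_ (+-identityʳ (f zero)) (sum-replicate-zero n)) (+-identityʳ (f zero))
∑-δ* {suc n} (suc c) f = ∑-δ* c (f ∘ suc)

∑-δ : ∀ {n} (c : Fin n) → ∑[ i < n ] δ c i ≡ 1
∑-δ c = trans (sum-cong-≗ (λ i → sym (*-identityʳ (δ c i)))) (∑-δ* c (λ _ → 1))

∑∑-distrib-+ : ∀ {m n} (f g : Fin m → Fin n → ℕ) →
  ∑[ i < m ] ∑[ j < n ] (f i j + g i j) ≡ ∑[ i < m ] ∑[ j < n ] f i j + ∑[ i < m ] ∑[ j < n ] g i j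
∑∑-distrib-+ f g =
  trans (sum-cong-≗ (λ i → ∑-distrib-+ (f i) (g i))) (∑-distrib-+ (λ i → sum (f i)) (λ i → sum (g i)))

∑∑-δ : ∀ {m n} (c : Fin m) (g : Fin m → Fin n → ℕ) →
  ∑[ i < m ] ∑[ j < n ] (δ c i * g i j) ≡ ∑[ j < n ] g c j
∑∑-δ c g = trans (sum-cong-≗ (λ i → sym (*-distribˡ-sum (δ c i) (g i)))) (∑-δ* c (λ i → sum (g i)))

∑-allFin : ∀ {n} (f : Fin n → ℕ) → List.sum (map f (allFin n)) ≡ ∑[ i < n ] f i
∑-allFin {n} f = trans (cong List.sum (map-tabulate (λ i → i) f)) (sum-tabulate f)
  where
  sum-tabulate : ∀ {m} (g : Fin m → ℕ) → List.sum (tabulate g) ≡ ∑[ i < m ] g i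
  sum-tabulate {zero}  g = refl
  sum-tabulate {suc m} g = cong (g zero +_) (sum-tabulate (g ∘ suc))

∑𝟙≤n : ∀ {n} (S : Fin n → Bool) → ∑[ i < n ] 𝟙 (S i) ≤ n
∑𝟙≤n {zero}  S = z≤n
∑𝟙≤n {suc n} S = +-mono-≤ (𝟙≤1 (S zero)) (∑𝟙≤n (S ∘ suc))

∑𝟙<n⇒∃false : ∀ {n} (S : Fin n → Bool) → ∑[ i < n ] 𝟙 (S i) < n → ∃ λ b → S b ≡ false
∑𝟙<n⇒∃false {suc n} S count<n with S zero in S₀
... | false = zero , S₀
... | true  = let b , Sb = ∑𝟙<n⇒∃false (S ∘ suc) (≤-pred count<n) in suc b , Sb

module _ {a} {A : Set a} where

  ∷ʳ≢[] : ∀ (xs : List A) {x} → xs ∷ʳ x ≢ []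
  ∷ʳ≢[] xs e = case ++-conicalʳ xs _ e of λ ()

  ∉-∷ : ∀ {x y : A} {ys} → x ≢ y → x ∉ ys → x ∉ y ∷ ys
  ∉-∷ x≢y _    (here x≡y) = x≢y x≡y
  ∉-∷ _   x∉ys (there x∈) = x∉ys x∈

  ∉-++ : ∀ {x : A} {xs ys} → x ∉ xs → x ∉ ys → x ∉ xs ++ ys
  ∉-++ {xs = xs} x∉xs x∉ys x∈ = either x∉xs x∉ys (∈-++⁻ xs x∈)

  ∈-ʳ++⁺ˡ : ∀ {x : A} xs {ys} → x ∈ xs → x ∈ xs ʳ++ ys
  ∈-ʳ++⁺ˡ xs {ys} x∈xs = Any.reverseAcc⁺ ys xs (inj₂ x∈xs)

  ∈-ʳ++⁺ʳ : ∀ {x : A} xs {ys} → x ∈ ys → x ∈ xs ʳ++ ys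
  ∈-ʳ++⁺ʳ xs {ys} x∈ys = Any.reverseAcc⁺ ys xs (inj₁ x∈ys)

  Disjoint-[]ʳ : ∀ {xs : List A} → Disjoint xs []
  Disjoint-[]ʳ (_ , ())

  Disjoint-∷⁺ʳ : ∀ {y : A} {xs ys} → y ∉ xs → Disjoint xs ys → Disjoint xs (y ∷ ys)
  Disjoint-∷⁺ʳ y∉xs _     (v∈xs , here refl)  = y∉xs v∈xs
  Disjoint-∷⁺ʳ _    xs#ys (v∈xs , there v∈ys) = xs#ys (v∈xs , v∈ys)

  Disjoint-[-]ˡ : ∀ {x : A} {ys} → x ∉ ys → Disjoint [ x ] ys
  Disjoint-[-]ˡ x∉ys (here refl , x∈ys) = x∉ys x∈ys

  Disjoint-++⁺ˡ : ∀ {xs ys zs : List A} → Disjoint xs zs → Disjoint ys zs → Disjoint (xs ++ ys) zs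
  Disjoint-++⁺ˡ {xs} xs#zs ys#zs (v∈ , v∈zs) =
    either (λ v∈xs → xs#zs (v∈xs , v∈zs)) (λ v∈ys → ys#zs (v∈ys , v∈zs)) (∈-++⁻ xs v∈)

  Disjoint-ʳ++⁺ʳ : ∀ {zs xs ys : List A} → Disjoint zs xs → Disjoint zs ys → Disjoint zs (xs ʳ++ ys)
  Disjoint-ʳ++⁺ʳ {xs = xs} {ys} zs#xs zs#ys (v∈zs , v∈) with Any.reverseAcc⁻ ys xs v∈
  ... | inj₁ v∈ys = zs#ys (v∈zs , v∈ys)
  ... | inj₂ v∈xs = zs#xs (v∈zs , v∈xs)

  Unique-∷⁺ : ∀ {x : A} {xs} → x ∉ xs → Unique xs → Unique (x ∷ xs)
  Unique-∷⁺ {xs = xs} x∉xs !xs = ¬Any⇒All¬ xs x∉xs ∷ !xs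

  Unique-∷ʳ⁺ : ∀ {x : A} {xs} → x ∉ xs → Unique xs → Unique (xs ∷ʳ x)
  Unique-∷ʳ⁺ x∉xs !xs = ++⁺ !xs ([] ∷ []) (λ { (v∈xs , here refl) → x∉xs v∈xs })

  Unique-++⁻ : ∀ (xs : List A) {ys} → Unique (xs ++ ys) → Unique xs × Unique ys × Disjoint xs ys
  Unique-++⁻ []       !ys = [] , !ys , λ ()
  Unique-++⁻ (x ∷ xs) !x∷xs++ys@(_ ∷ !xs++ys) =
    let !xs , !ys , xs#ys = Unique-++⁻ xs !xs++ys
        x∉ = Unique[x∷xs]⇒x∉xs !x∷xs++ys
    in  Unique-∷⁺ (x∉ ∘ ∈-++⁺ˡ) !xs , !ys ,
        λ { (here refl , v∈ys) → x∉ (∈-++⁺ʳ xs v∈ys) ; (there v∈xs , v∈ys) → xs#ys (v∈xs , v∈ys) }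

  record Distinct (u v : A) (p q w : List A) : Set a where
    field
      u≢v : u ≢ v
      u∉p : u ∉ p
      u∉q : u ∉ q
      u∉w : u ∉ w
      v∉p : v ∉ p
      v∉q : v ∉ q
      v∉w : v ∉ w
      !p  : Unique p
      !q  : Unique q
      !w  : Unique w
      p#q : Disjoint p q
      p#w : Disjoint p w
      q#w : Disjoint q w

  module _ {u v : A} {p q w : List A} where

    Unique⇒Distinct : Unique (u ∷ v ∷ p ++ q ++ w) → Distinct u v p q w
    Unique⇒Distinct !all@(_ ∷ !v∷pqw@(_ ∷ !pqw)) with Unique-++⁻ p !pqw
    ... | !p , !qw , p#qw with Unique-++⁻ q !qw
    ...   | !q , !w , q#w = record
      { u≢v = u∉ ∘ here ; u∉p = u∉ ∘ there ∘ ∈-++⁺ˡ ; u∉q = u∉ ∘ there ∘ ∈-++⁺ʳ p ∘ ∈-++⁺ˡ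
      ; u∉w = u∉ ∘ there ∘ ∈-++⁺ʳ p ∘ ∈-++⁺ʳ q
      ; v∉p = v∉ ∘ ∈-++⁺ˡ ; v∉q = v∉ ∘ ∈-++⁺ʳ p ∘ ∈-++⁺ˡ ; v∉w = v∉ ∘ ∈-++⁺ʳ p ∘ ∈-++⁺ʳ q
      ; !p = !p ; !q = !q ; !w = !w
      ; p#q = λ (x∈p , x∈q) → p#qw (x∈p , ∈-++⁺ˡ x∈q)
      ; p#w = λ (x∈p , x∈w) → p#qw (x∈p , ∈-++⁺ʳ q x∈w)
      ; q#w = q#w
      }
      where
      u∉ = Unique[x∷xs]⇒x∉xs !all
      v∉ = Unique[x∷xs]⇒x∉xs !v∷pqw

    Distinct⇒Unique : Distinct u v p q w → Unique (u ∷ v ∷ p ++ q ++ w)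
    Distinct⇒Unique d =
      Unique-∷⁺ (∉-∷ u≢v (∉-++ u∉p (∉-++ u∉q u∉w))) (Unique-∷⁺ (∉-++ v∉p (∉-++ v∉q v∉w))
        (++⁺ !p (++⁺ !q !w q#w) (λ (x∈p , x∈qw) →
          either (λ x∈q → p#q (x∈p , x∈q)) (λ x∈w → p#w (x∈p , x∈w)) (∈-++⁻ q x∈qw))))
      where open Distinct d

    Distinct-swap : Distinct u v p q w → Distinct u v q p w
    Distinct-swap d = record
      { u≢v = u≢v ; u∉p = u∉q ; u∉q = u∉p ; u∉w = u∉w ; v∉p = v∉q ; v∉q = v∉p ; v∉w = v∉w
      ; !p = !q ; !q = !p ; !w = !w ; p#q = Disjoint.sym p#q ; p#w = q#w ; q#w = p#w }
      where open Distinct d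

    Distinct-rotate : Distinct u v p q w → Distinct u v w p q
    Distinct-rotate d = record
      { u≢v = u≢v ; u∉p = u∉w ; u∉q = u∉p ; u∉w = u∉q ; v∉p = v∉w ; v∉q = v∉p ; v∉w = v∉q
      ; !p = !w ; !q = !p ; !w = !q ; p#q = Disjoint.sym p#w ; p#w = Disjoint.sym q#w ; q#w = p#q }
      where open Distinct d

    Distinct-merge : Distinct u v p q w → Distinct u v [] q (w ++ p)
    Distinct-merge d = record
      { u≢v = u≢v ; u∉p = λ () ; u∉q = u∉q ; u∉w = ∉-++ u∉w u∉p
      ; v∉p = λ () ; v∉q = v∉q ; v∉w = ∉-++ v∉w v∉p
      ; !p = [] ; !q = !q ; !w = ++⁺ !w !p (Disjoint.sym p#w)
      ; p#q = λ () ; p#w = λ ()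
      ; q#w = λ (x∈q , x∈wp) → either (λ x∈w → q#w (x∈q , x∈w)) (λ x∈p → p#q (x∈p , x∈q)) (∈-++⁻ w x∈wp)
      }
      where open Distinct d

  Distinct-detach : ∀ {u v x : A} {q w} → Distinct u v [] (x ∷ q) w → Distinct u v q (x ∷ []) w
  Distinct-detach d = record
    { u≢v = u≢v ; u∉p = u∉q ∘ there ; u∉q = λ { (here u≡x) → u∉q (here u≡x) } ; u∉w = u∉w
    ; v∉p = v∉q ∘ there ; v∉q = λ { (here v≡x) → v∉q (here v≡x) } ; v∉w = v∉w
    ; !p = drop⁺ 1 !q ; !q = [] ∷ [] ; !w = !w
    ; p#q = λ { (y∈q , here refl) → Unique[x∷xs]⇒x∉xs !q y∈q }
    ; p#w = λ (y∈q , y∈w) → q#w (there y∈q , y∈w)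
    ; q#w = λ { (here refl , y∈w) → q#w (here refl , y∈w) }
    }
    where open Distinct d

data SameEdge {a} {A : Set a} : A → A → A → A → Set a where
  same    : ∀ {x y} → SameEdge x y x y
  flipped : ∀ {x y} → SameEdge x y y x

module _ {a} {A : Set a} where

  SameEdge-sym : ∀ {i j x y : A} → SameEdge i j x y → SameEdge j i x y
  SameEdge-sym same    = flipped
  SameEdge-sym flipped = same

  SameEdge-loop : ∀ {i x y : A} → SameEdge i i x y → x ≡ y
  SameEdge-loop same    = refl
  SameEdge-loop flipped = refl

  SameEdge-endˡ : ∀ {i j x y : A} → SameEdge i j x y → x ≡ i ⊎ x ≡ j
  SameEdge-endˡ same    = inj₁ refl
  SameEdge-endˡ flipped = inj₂ refl

  SameEdge-endʳ : ∀ {i j x y : A} → SameEdge i j x y → y ≡ i ⊎ y ≡ j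
  SameEdge-endʳ same    = inj₂ refl
  SameEdge-endʳ flipped = inj₁ refl

  SameEdge-shared : ∀ {i j x y x′ y′ : A} → SameEdge i j x y → SameEdge i j x′ y′ → x ≡ x′ ⊎ x ≡ y′
  SameEdge-shared same    same    = inj₁ refl
  SameEdge-shared same    flipped = inj₂ refl
  SameEdge-shared flipped same    = inj₂ refl
  SameEdge-shared flipped flipped = inj₁ refl

module _ {n : ℕ} where

  sameEdge? : (i j x y : Fin n) → Dec (SameEdge i j x y)
  sameEdge? i j x y = map′ from to ((i ≟ x ×-dec j ≟ y) ⊎-dec (i ≟ y ×-dec j ≟ x))
    where
    from : (i ≡ x × j ≡ y) ⊎ (i ≡ y × j ≡ x) → SameEdge i j x y
    from (inj₁ (refl , refl)) = same
    from (inj₂ (refl , refl)) = flipped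
    to : SameEdge i j x y → (i ≡ x × j ≡ y) ⊎ (i ≡ y × j ≡ x)
    to same    = inj₁ (refl , refl)
    to flipped = inj₂ (refl , refl)

  ∑-sameEdge : ∀ {x y} → x ≢ y → ∀ i → ∑[ j < n ] 𝟙 (does (sameEdge? i j x y)) ≡ δ x i + δ y i
  ∑-sameEdge {x} {y} x≢y i = begin
    ∑[ j < n ] 𝟙 (does (sameEdge? i j x y))                   ≡⟨ sum-cong-≗ split ⟩
    ∑[ j < n ] (δ x i * δ y j + δ y i * δ x j)                ≡⟨ ∑-distrib-+ (λ j → δ x i * δ y j) (λ j → δ y i * δ x j) ⟩
    ∑[ j < n ] (δ x i * δ y j) + ∑[ j < n ] (δ y i * δ x j)
      ≡⟨ cong₂ _+_ (*-distribˡ-sum (δ x i) (δ y)) (*-distribˡ-sum (δ y i) (δ x)) ⟨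
    δ x i * ∑[ j < n ] δ y j + δ y i * ∑[ j < n ] δ x j      ≡⟨ cong₂ (λ s t → δ x i * s + δ y i * t) (∑-δ y) (∑-δ x) ⟩
    δ x i * 1 + δ y i * 1                                     ≡⟨ cong₂ _+_ (*-identityʳ (δ x i)) (*-identityʳ (δ y i)) ⟩
    δ x i + δ y i                                             ∎
    where
    open ≡-Reasoning
    split : ∀ j → 𝟙 (does (sameEdge? i j x y)) ≡ δ x i * δ y j + δ y i * δ x j
    split j = trans (𝟙-⊎-dec (λ { ((refl , refl) , (x≡y , _)) → x≢y x≡y }) (i ≟ x ×-dec j ≟ y) (i ≟ y ×-dec j ≟ x))
                    (cong₂ _+_ (𝟙-∧ (does (i ≟ x)) (does (j ≟ y))) (𝟙-∧ (does (i ≟ y)) (does (j ≟ x))))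

module _ {n : ℕ} (G : Graph n) where

  adj-SameEdge : ∀ {i j x y} → SameEdge i j x y → adj G i j ≡ adj G x y
  adj-SameEdge same    = refl
  adj-SameEdge flipped = adj-sym G _ _

  deg≡∑ : ∀ i → deg G i ≡ ∑[ j < n ] 𝟙 (adj G i j)
  deg≡∑ i = ∑-allFin (λ j → 𝟙 (adj G i j))

  ConsecAdj-++⁻ : ∀ xs {x ys} → ConsecAdj G (xs ++ x ∷ ys) → ConsecAdj G (xs ∷ʳ x) × ConsecAdj G (x ∷ ys)
  ConsecAdj-++⁻ []             path           = tt , path
  ConsecAdj-++⁻ (x₁ ∷ [])      (x₁~x , path)  = (x₁~x , tt) , path
  ConsecAdj-++⁻ (x₁ ∷ x₂ ∷ xs) (x₁~x₂ , path) = Data.Product.map₁ (x₁~x₂ ,_) (ConsecAdj-++⁻ (x₂ ∷ xs) path)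

  ConsecAdj-++⁺ : ∀ xs {x ys} → ConsecAdj G (xs ∷ʳ x) → ConsecAdj G (x ∷ ys) → ConsecAdj G (xs ++ x ∷ ys)
  ConsecAdj-++⁺ []             _           right = right
  ConsecAdj-++⁺ (x₁ ∷ [])      (x₁~x , _)  right = x₁~x , right
  ConsecAdj-++⁺ (x₁ ∷ x₂ ∷ xs) (x₁~x₂ , p) right = x₁~x₂ , ConsecAdj-++⁺ (x₂ ∷ xs) p right

  ConsecAdj-∷ʳ⁻ : ∀ xs {x z} → ConsecAdj G (xs ∷ʳ x ∷ʳ z) → ConsecAdj G (xs ∷ʳ x) × Adj G x z
  ConsecAdj-∷ʳ⁻ xs {x} {z} path =
    Data.Product.map₂ proj₁ (ConsecAdj-++⁻ xs (subst (ConsecAdj G) (++-assoc xs [ x ] [ z ]) path))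

  ConsecAdj-bridge : ∀ {u v} w b x r → ConsecAdj G (u ∷ w ∷ʳ b) → Adj G b x → ConsecAdj G (x ∷ r ∷ʳ v) →
    ConsecAdj G (u ∷ ((w ∷ʳ b) ++ x ∷ r) ++ [ v ])
  ConsecAdj-bridge {u} {v} w b x r left b~x right =
    subst (ConsecAdj G) (cong (u ∷_) (sym reassoc)) (ConsecAdj-++⁺ (u ∷ w) left (b~x , right))
    where
    reassoc : ((w ∷ʳ b) ++ x ∷ r) ++ [ v ] ≡ w ++ b ∷ x ∷ r ∷ʳ v
    reassoc = trans (++-assoc (w ∷ʳ b) (x ∷ r) [ v ]) (++-assoc w [ b ] (x ∷ r ∷ʳ v))

-- Vertex sets and the edges inside them

module _ {n : ℕ} where

  insert : Fin n → (Fin n → Bool) → Fin n → Bool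
  insert c S i = does (i ≟ c) ∨ S i

  insert-⊇ : ∀ {S c y} → S y ≡ true → insert c S y ≡ true
  insert-⊇ {S} {c} {y} Sy = trans (cong (does (y ≟ c) ∨_) Sy) (∨-zeroʳ (does (y ≟ c)))

  𝟙-insert : ∀ {S c} → S c ≡ false → ∀ i → 𝟙 (insert c S i) ≡ δ c i + 𝟙 (S i)
  𝟙-insert {S} {c} Sc≡false i with i ≟ c
  ... | yes refl rewrite Sc≡false = refl
  ... | no  _    = refl

  size : (Fin n → Bool) → ℕ
  size S = ∑[ i < n ] 𝟙 (S i)

  size-insert : ∀ {S c} → S c ≡ false → size (insert c S) ≡ suc (size S)
  size-insert {S} {c} Sc≡false = begin
    size (insert c S)             ≡⟨ sum-cong-≗ (𝟙-insert Sc≡false) ⟩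
    ∑[ i < n ] (δ c i + 𝟙 (S i))  ≡⟨ ∑-distrib-+ (δ c) (𝟙 ∘ S) ⟩
    ∑[ i < n ] δ c i + size S     ≡⟨ cong (_+ size S) (∑-δ c) ⟩
    suc (size S)                  ∎
    where open ≡-Reasoning

  -- ⟦ c ∷ L ⟧ unfolds definitionally to insert c ⟦ L ⟧.
  ⟦_⟧ : List (Fin n) → Fin n → Bool
  ⟦ L ⟧ i = does (any? (i ≟_) L)

  ⟦⟧-∈ : ∀ {x L} → x ∈ L → ⟦ L ⟧ x ≡ true
  ⟦⟧-∈ {x} {L} = dec-true (any? (x ≟_) L)

  ⟦⟧-∉ : ∀ {x L} → x ∉ L → ⟦ L ⟧ x ≡ false
  ⟦⟧-∉ {x} {L} = dec-false (any? (x ≟_) L)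

  size-⟦⟧ : ∀ {L} → Unique L → size ⟦ L ⟧ ≡ length L
  size-⟦⟧ {[]}    []            = sum-replicate-zero n
  size-⟦⟧ {x ∷ L} !x∷L@(_ ∷ !L) = trans (size-insert (⟦⟧-∉ (Unique[x∷xs]⇒x∉xs !x∷L))) (cong suc (size-⟦⟧ !L))

  length-≤-∑ : ∀ {L} {f : Fin n → ℕ} → Unique L → (∀ {x} → x ∈ L → 1 ≤ f x) → length L ≤ ∑[ i < n ] f i
  length-≤-∑ {L} {f} !L f≥1 = subst (_≤ sum f) (size-⟦⟧ !L) (∑-mono-≤ member≤)
    where
    member≤ : ∀ i → 𝟙 (⟦ L ⟧ i) ≤ f i
    member≤ i with any? (i ≟_) L
    ... | yes i∈L = f≥1 i∈L
    ... | no  _   = z≤n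

  module _ (G : Graph n) where

    arcs : (Fin n → Bool) → ℕ
    arcs S = ∑[ i < n ] ∑[ j < n ] (𝟙 (S i) * 𝟙 (S j) * 𝟙 (adj G i j))

    degIn : (Fin n → Bool) → Fin n → ℕ
    degIn S c = ∑[ j < n ] (𝟙 (S j) * 𝟙 (adj G c j))

    -- Expand both factors 𝟙 (insert c S _) as δ c + 𝟙 ∘ S: each cross term counts the neighbours of c in S.
    arcs-insert : ∀ {S c} → S c ≡ false → 2 * degIn S c + arcs S ≤ arcs (insert c S)
    arcs-insert {S} {c} Sc≡false = begin
      2 * degIn S c + arcs S                      ≡⟨ cong (_+ ∑∑ A) doubled ⟩
      ∑∑ B + ∑∑ C + ∑∑ A                          ≡⟨ split ⟨
      ∑∑ (λ i j → B i j + C i j + A i j)          ≤⟨ ∑-mono-≤ (λ i → ∑-mono-≤ (λ j → m≤m+n _ (D i j))) ⟩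
      ∑∑ (λ i j → B i j + C i j + A i j + D i j)  ≡⟨ sum-cong-≗ (λ i → sum-cong-≗ (expand i)) ⟩
      arcs (insert c S)                           ∎
      where
      open ≤-Reasoning
      s : Fin n → ℕ
      s i = 𝟙 (S i)
      a : Fin n → Fin n → ℕ
      a i j = 𝟙 (adj G i j)
      ∑∑ : (Fin n → Fin n → ℕ) → ℕ
      ∑∑ f = ∑[ i < n ] ∑[ j < n ] f i j
      A B C D : Fin n → Fin n → ℕ
      A i j = s i * s j * a i j
      B i j = δ c i * (s j * a i j)
      C i j = δ c j * (s i * a i j)
      D i j = δ c i * δ c j * a i j
      B-sum : ∑∑ B ≡ degIn S c
      B-sum = ∑∑-δ c (λ i j → s j * a i j)
      C-sum : ∑∑ C ≡ degIn S c
      C-sum = begin-equality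
        ∑∑ C                         ≡⟨ ∑-comm C ⟩
        ∑[ j < n ] ∑[ i < n ] C i j  ≡⟨ ∑∑-δ c (λ j i → s i * a i j) ⟩
        ∑[ i < n ] (s i * a i c)     ≡⟨ sum-cong-≗ (λ i → cong (λ b → s i * 𝟙 b) (adj-sym G i c)) ⟩
        degIn S c                    ∎
      doubled : 2 * degIn S c ≡ ∑∑ B + ∑∑ C
      doubled = trans (cong (degIn S c +_) (+-identityʳ (degIn S c))) (sym (cong₂ _+_ B-sum C-sum))
      split : ∑∑ (λ i j → B i j + C i j + A i j) ≡ ∑∑ B + ∑∑ C + ∑∑ A
      split = trans (∑∑-distrib-+ (λ i j → B i j + C i j) A) (cong (_+ ∑∑ A) (∑∑-distrib-+ B C))
      expand : ∀ i j → B i j + C i j + A i j + D i j ≡ 𝟙 (insert c S i) * 𝟙 (insert c S j) * a i j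
      expand i j = trans (ring (s i) (s j) (δ c i) (δ c j) (a i j))
        (cong₂ (λ x y → x * y * a i j) (sym (𝟙-insert Sc≡false i)) (sym (𝟙-insert Sc≡false j)))
        where
        ring : ∀ x y u v e → u * (y * e) + v * (x * e) + x * y * e + u * v * e ≡ (u + x) * (v + y) * e
        ring = solve-∀

    arcs-insert-neighbours : ∀ {S c NL} → S c ≡ false → Unique NL →
      All (λ y → S y ≡ true) NL → All (Adj G c) NL → 2 * length NL + arcs S ≤ arcs (insert c S)
    arcs-insert-neighbours {S} {c} {NL} Sc≡false !NL NL⊆S NL⊆N =
      ≤-trans (+-monoˡ-≤ (arcs S) (*-monoʳ-≤ 2 (length-≤-∑ !NL neighbour))) (arcs-insert Sc≡false)
      where
      neighbour : ∀ {y} → y ∈ NL → 1 ≤ 𝟙 (S y) * 𝟙 (adj G c y)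
      neighbour y∈NL rewrite All.lookup NL⊆S y∈NL | All.lookup NL⊆N y∈NL = ≤-refl

    full : Fin n → Bool
    full _ = true

    arcs≤arcs-full : ∀ S → arcs S ≤ arcs full
    arcs≤arcs-full S = ∑-mono-≤ (λ i → ∑-mono-≤ (λ j →
      *-monoˡ-≤ (𝟙 (adj G i j)) (*-mono-≤ (𝟙≤1 (S i)) (𝟙≤1 (S j)))))

    arcs-full≤2*numEdges : arcs full ≤ 2 * numEdges G
    arcs-full≤2*numEdges = begin
      arcs full                              ≤⟨ ∑-mono-≤ (λ i → ∑-mono-≤ (arc≤ i)) ⟩
      ∑[ i < n ] ∑[ j < n ] (E i j + E j i)  ≡⟨ ∑∑-distrib-+ E (λ i j → E j i) ⟩
      ∑∑E + ∑[ i < n ] ∑[ j < n ] E j i      ≡⟨ cong (∑∑E +_) (∑-comm E) ⟨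
      ∑∑E + ∑∑E                              ≡⟨ cong (∑∑E +_) (+-identityʳ ∑∑E) ⟨
      2 * ∑∑E                                ≡⟨ cong (2 *_) numEdges≡∑∑E ⟨
      2 * numEdges G                         ∎
      where
      open ≤-Reasoning
      E : Fin n → Fin n → ℕ
      E i j = 𝟙 (adj G i j ∧ ⌊ i <? j ⌋)
      ∑∑E = ∑[ i < n ] ∑[ j < n ] E i j
      numEdges≡∑∑E : numEdges G ≡ ∑∑E
      numEdges≡∑∑E = trans (∑-allFin (λ i → List.sum (map (E i) (allFin n)))) (sum-cong-≗ (λ i → ∑-allFin (E i)))
      arc≤ : ∀ i j → 1 * 1 * 𝟙 (adj G i j) ≤ E i j + E j i
      arc≤ i j with adj G i j in i~j
      ... | false = z≤n
      ... | true with <-cmp i j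
      ...   | tri< i<j _ _ rewrite ⌊⌋-true (i <? j) i<j = s≤s z≤n
      ...   | tri≈ _ refl _ with () ← trans (sym i~j) (adj-irr G i)
      ...   | tri> _ _ j<i rewrite adj-sym G j i | i~j | ⌊⌋-true (j <? i) j<i = m≤n+m 1 _

    leaving-edge : ∀ {S : Fin n → Bool} {y b} → Star (Adj G) y b → S y ≡ true → S b ≡ false →
      ∃ λ a → ∃ λ c → S a ≡ true × S c ≡ false × Adj G a c
    leaving-edge ε Sy Sb with () ← trans (sym Sy) Sb
    leaving-edge {S} {y} (_◅_ {j = z} y~z z~*b) Sy Sb with S z in Sz
    ... | true  = leaving-edge z~*b Sz Sb
    ... | false = y , z , Sy , Sz , y~z

    arcs-connected : Connected G → ∀ {S y} k → S y ≡ true → size S + k ≡ n → 2 * k + arcs S ≤ arcs full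
    arcs-connected conn {S} zero Sy _ = arcs≤arcs-full S
    arcs-connected conn {S} {y} (suc k) Sy size+k≡n
      with b , Sb ← ∑𝟙<n⇒∃false S (subst (size S <_) size+k≡n (m<m+n (size S) (s≤s z≤n)))
      with a , c , Sa , Sc , a~c ← leaving-edge (conn y b) Sy Sb = begin
        2 * suc k + arcs S                ≡⟨ regroup k (arcs S) ⟩
        2 * k + (2 * 1 + arcs S)          ≤⟨ +-monoʳ-≤ (2 * k) (arcs-insert-neighbours Sc ([] ∷ []) (Sa ∷ []) (c~a ∷ [])) ⟩
        2 * k + arcs (insert c S)         ≤⟨ arcs-connected conn k (insert-⊇ {S} {c} Sy) size′+k≡n ⟩
        arcs full                         ∎
      where
      open ≤-Reasoning
      c~a : Adj G c a
      c~a = trans (adj-sym G c a) a~c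
      size′+k≡n : size (insert c S) + k ≡ n
      size′+k≡n = trans (cong (_+ k) (size-insert Sc)) (trans (sym (+-suc (size S) k)) size+k≡n)
      regroup : ∀ k x → 2 * suc k + x ≡ 2 * k + (2 * 1 + x)
      regroup = solve-∀

    -- arcs counts ordered pairs, so this says e(G[L]) ≥ |L| - 1 + k.
    record CycleRank≥ (L : List (Fin n)) (k : ℕ) : Set where
      constructor cycleRank≥
      field bound : 2 * (size ⟦ L ⟧ + k) ≤ arcs ⟦ L ⟧ + 2

    CycleRank≥-insert : ∀ {L c y ends k} → c ∉ L → All (_∈ L) (y ∷ ends) → Unique (y ∷ ends) →
      All (Adj G c) (y ∷ ends) → CycleRank≥ L k → CycleRank≥ (c ∷ L) (length ends + k)
    CycleRank≥-insert {L} {c} {y} {ends} {k} c∉L NL⊆L !NL NL⊆N (cycleRank≥ rank) = cycleRank≥ (begin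
      2 * (size ⟦ c ∷ L ⟧ + (e + k))      ≡⟨ cong (λ m → 2 * (m + (e + k))) (size-insert (⟦⟧-∉ c∉L)) ⟩
      2 * (suc (size ⟦ L ⟧) + (e + k))    ≡⟨ regroup (size ⟦ L ⟧) e k ⟩
      2 * suc e + 2 * (size ⟦ L ⟧ + k)    ≤⟨ +-monoʳ-≤ (2 * suc e) rank ⟩
      2 * suc e + (arcs ⟦ L ⟧ + 2)        ≡⟨ +-assoc (2 * suc e) (arcs ⟦ L ⟧) 2 ⟨
      2 * suc e + arcs ⟦ L ⟧ + 2          ≤⟨ +-monoˡ-≤ 2 (arcs-insert-neighbours (⟦⟧-∉ c∉L) !NL (All.map ⟦⟧-∈ NL⊆L) NL⊆N) ⟩
      arcs ⟦ c ∷ L ⟧ + 2                  ∎)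
      where
      open ≤-Reasoning
      e = length ends
      regroup : ∀ s e k → 2 * (suc s + (e + k)) ≡ 2 * suc e + 2 * (s + k)
      regroup = solve-∀

  Bicyclic : Graph n → Set
  Bicyclic G = Connected G × numEdges G ≡ suc n

  -- With k = n - |L|, growing L along leaving edges gives 2k + arcs L ≤ arcs V ≤ 2(n + 1),
  -- while cycle rank 3 means arcs L ≥ 2|L| + 4.
  bicyclic⇒¬CycleRank≥3 : ∀ {G L y} → Bicyclic G → y ∈ L → ¬ CycleRank≥ G L 3
  bicyclic⇒¬CycleRank≥3 {G} {L} (conn , edges) y∈L (cycleRank≥ rank) = 6≰4 (+-cancelˡ-≤ (2 * n) 6 4 (begin
    2 * n + 6                       ≡⟨ cong (λ m → 2 * m + 6) size+k≡n ⟨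
    2 * (size ⟦ L ⟧ + k) + 6        ≡⟨ regroup (size ⟦ L ⟧) k ⟩
    2 * k + 2 * (size ⟦ L ⟧ + 3)    ≤⟨ +-monoʳ-≤ (2 * k) rank ⟩
    2 * k + (arcs G ⟦ L ⟧ + 2)      ≡⟨ +-assoc (2 * k) (arcs G ⟦ L ⟧) 2 ⟨
    2 * k + arcs G ⟦ L ⟧ + 2        ≤⟨ +-monoˡ-≤ 2 (arcs-connected G conn k (⟦⟧-∈ y∈L) size+k≡n) ⟩
    arcs G (full G) + 2             ≤⟨ +-monoˡ-≤ 2 (arcs-full≤2*numEdges G) ⟩
    2 * numEdges G + 2              ≡⟨ cong (λ m → 2 * m + 2) edges ⟩
    2 * suc n + 2                   ≡⟨ plus-four n ⟩
    2 * n + 4                       ∎))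
    where
    open ≤-Reasoning
    k = n ∸ size ⟦ L ⟧
    size+k≡n : size ⟦ L ⟧ + k ≡ n
    size+k≡n = m+[n∸m]≡n (∑𝟙≤n ⟦ L ⟧)
    regroup : ∀ s k → 2 * (s + k) + 6 ≡ 2 * k + 2 * (s + 3)
    regroup = solve-∀
    plus-four : ∀ n → 2 * suc n + 2 ≡ 2 * n + 4
    plus-four = solve-∀
    6≰4 : ¬ 6 ≤ 4
    6≰4 (s≤s (s≤s (s≤s (s≤s ()))))

  module _ {G : Graph n} where

    CycleRank≥-path : ∀ {L k y} xs x {ends} → All (_∈ L) (y ∷ ends) → Unique (y ∷ ends) →
      ConsecAdj G (y ∷ xs ∷ʳ x) → All (Adj G x) ends → Unique (xs ∷ʳ x) → Disjoint (xs ∷ʳ x) L →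
      CycleRank≥ G L k → CycleRank≥ G ((xs ∷ʳ x) ʳ++ L) (length ends + k)
    CycleRank≥-path {y = y} [] x ends⊆L !ends (y~x , _) x~ends _ x#L =
      CycleRank≥-insert G (λ x∈L → x#L (here refl , x∈L)) ends⊆L !ends (trans (adj-sym G x y) y~x ∷ x~ends)
    CycleRank≥-path {L} {y = y} (x′ ∷ xs) x {ends} ends⊆L (_ ∷ !ends) (y~x′ , path) x~ends (x′∉ ∷ !xs) x#L rank =
      CycleRank≥-path xs x (here refl ∷ All.map there (All.tail ends⊆L)) (x′∉ends ∷ !ends) path x~ends !xs x#L′
        (CycleRank≥-insert G x′∉L (All.head ends⊆L ∷ []) ([] ∷ []) (trans (adj-sym G x′ y) y~x′ ∷ []) rank)
      where
      x′∉L : x′ ∉ L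
      x′∉L x′∈L = x#L (here refl , x′∈L)
      x′∉ends : All (x′ ≢_) ends
      x′∉ends = All.map (λ z∈L x′≡z → x′∉L (subst (_∈ L) (sym x′≡z) z∈L)) (All.tail ends⊆L)
      x#L′ : Disjoint (xs ∷ʳ x) (x′ ∷ L)
      x#L′ (v∈ , here refl)  = All.lookup x′∉ v∈ refl
      x#L′ (v∈ , there v∈L) = x#L (there v∈ , v∈L)

    CycleRank≥-ear : ∀ {L k y z} xs → xs ≢ [] → y ∈ L → z ∈ L → y ≢ z → ConsecAdj G (y ∷ xs ++ [ z ]) →
      Unique xs → Disjoint xs L → CycleRank≥ G L k → CycleRank≥ G (xs ʳ++ L) (suc k)
    CycleRank≥-ear {y = y} xs xs≢[] y∈L z∈L y≢z path !xs xs#L with initLast xs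
    ... | []       = ⊥-elim (xs≢[] refl)
    ... | ys ∷ʳ′ x = let path′ , x~z = ConsecAdj-∷ʳ⁻ G (y ∷ ys) path in
      CycleRank≥-path ys x (y∈L ∷ z∈L ∷ []) ((y≢z ∷ []) ∷ [] ∷ []) path′ (x~z ∷ []) !xs xs#L

    CycleRank≥-singleton : ∀ u → CycleRank≥ G (u ∷ []) 0
    CycleRank≥-singleton u = cycleRank≥
      (subst (_≤ arcs G ⟦ u ∷ [] ⟧ + 2) (cong (λ s → 2 * (s + 0)) (sym (size-⟦⟧ {L = u ∷ []} ([] ∷ [])))) (m≤n+m 2 _))

    CycleRank≥-edge : ∀ {u v} → Adj G u v → u ≢ v → CycleRank≥ G (v ∷ u ∷ []) 0
    CycleRank≥-edge {u} {v} u~v u≢v = CycleRank≥-path [] v (here refl ∷ []) ([] ∷ []) (u~v , tt) [] ([] ∷ [])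
      (Disjoint-∷⁺ʳ (∉-∷ u≢v λ ()) Disjoint-[]ʳ) (CycleRank≥-singleton u)

-- Theta subgraphs and the chords they cannot have

module _ {n : ℕ} where

  record Theta (G : Graph n) (u v : Fin n) (p q w : List (Fin n)) : Set where
    field
      path₁    : ConsecAdj G (u ∷ p ++ [ v ])
      path₂    : ConsecAdj G (u ∷ q ++ [ v ])
      path₃    : ConsecAdj G (u ∷ w ++ [ v ])
      distinct : Distinct u v p q w

  module _ {G : Graph n} {u v : Fin n} {p q w : List (Fin n)} (θ : Theta G u v p q w) where
    open Theta θ

    Theta-swap : Theta G u v q p w
    Theta-swap = record { path₁ = path₂ ; path₂ = path₁ ; path₃ = path₃ ; distinct = Distinct-swap distinct }

    Theta-rotate : Theta G u v w p q
    Theta-rotate = record { path₁ = path₃ ; path₂ = path₁ ; path₃ = path₂ ; distinct = Distinct-rotate distinct }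

  module _ {G : Graph n} (bicyclic : Bicyclic G) {u v : Fin n} where

    ends-nonadjacent : ∀ {p q w} → Theta G u v p q w → p ≢ [] → q ≢ [] → w ≢ [] → adj G u v ≡ false
    ends-nonadjacent {p} {q} {w} θ p≢[] q≢[] w≢[] = ¬-not λ u~v →
      bicyclic⇒¬CycleRank≥3 bicyclic (∈-ʳ++⁺ʳ w (∈-ʳ++⁺ʳ q (∈-ʳ++⁺ʳ p u∈L₁))) (rank₃ u~v)
      where
      open Theta θ
      open Distinct distinct
      L₁ = v ∷ u ∷ []
      u∈L₁ : u ∈ L₁
      u∈L₁ = there (here refl)
      v∈L₁ : v ∈ L₁
      v∈L₁ = here refl
      rank₃ : Adj G u v → CycleRank≥ G (w ʳ++ q ʳ++ p ʳ++ L₁) 3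
      rank₃ u~v =
        CycleRank≥-ear w w≢[] (∈-ʳ++⁺ʳ q (∈-ʳ++⁺ʳ p u∈L₁)) (∈-ʳ++⁺ʳ q (∈-ʳ++⁺ʳ p v∈L₁)) u≢v path₃ !w
          (Disjoint-ʳ++⁺ʳ (Disjoint.sym q#w)
            (Disjoint-ʳ++⁺ʳ (Disjoint.sym p#w) (Disjoint-∷⁺ʳ v∉w (Disjoint-∷⁺ʳ u∉w Disjoint-[]ʳ))))
        (CycleRank≥-ear q q≢[] (∈-ʳ++⁺ʳ p u∈L₁) (∈-ʳ++⁺ʳ p v∈L₁) u≢v path₂ !q
          (Disjoint-ʳ++⁺ʳ (Disjoint.sym p#q) (Disjoint-∷⁺ʳ v∉q (Disjoint-∷⁺ʳ u∉q Disjoint-[]ʳ)))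
        (CycleRank≥-ear p p≢[] u∈L₁ v∈L₁ u≢v path₁ !p (Disjoint-∷⁺ʳ v∉p (Disjoint-∷⁺ʳ u∉p Disjoint-[]ʳ))
        (CycleRank≥-edge u~v u≢v)))

    first-last-nonadjacent : ∀ {a p q w b} → Theta G u v (a ∷ p) q (w ∷ʳ b) → q ≢ [] → adj G a b ≡ false
    first-last-nonadjacent {a} {p} {q} {w} {b} θ q≢[] = ¬-not λ a~b →
      bicyclic⇒¬CycleRank≥3 bicyclic (∈-ʳ++⁺ʳ q (∈-ʳ++⁺ʳ (w ∷ʳ b) u∈L₁)) (rank₃ a~b)
      where
      open Theta θ
      open Distinct distinct
      L₁ = ((a ∷ p) ∷ʳ v) ʳ++ u ∷ []
      u∈L₁ : u ∈ L₁
      u∈L₁ = ∈-ʳ++⁺ʳ ((a ∷ p) ∷ʳ v) (here refl)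
      v∈L₁ : v ∈ L₁
      v∈L₁ = ∈-ʳ++⁺ˡ ((a ∷ p) ∷ʳ v) (∈-++⁺ʳ (a ∷ p) (here refl))
      a∈L₁ : a ∈ L₁
      a∈L₁ = ∈-ʳ++⁺ˡ ((a ∷ p) ∷ʳ v) (here refl)
      rank₁ : CycleRank≥ G L₁ 0
      rank₁ = CycleRank≥-path (a ∷ p) v (here refl ∷ []) ([] ∷ []) path₁ [] (Unique-∷ʳ⁺ v∉p !p)
        (Disjoint-∷⁺ʳ (∉-++ u∉p (∉-∷ u≢v λ ())) Disjoint-[]ʳ) (CycleRank≥-singleton u)
      rank₂ : Adj G a b → CycleRank≥ G ((w ∷ʳ b) ʳ++ L₁) 2
      rank₂ a~b = let path′ , b~v = ConsecAdj-∷ʳ⁻ G (u ∷ w) path₃ in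
        CycleRank≥-path w b (u∈L₁ ∷ v∈L₁ ∷ a∈L₁ ∷ []) !uva path′ (b~v ∷ trans (adj-sym G b a) a~b ∷ []) !w
          (Disjoint-ʳ++⁺ʳ (Disjoint.sym (Disjoint-++⁺ˡ p#w (Disjoint-[-]ˡ v∉w))) (Disjoint-∷⁺ʳ u∉w Disjoint-[]ʳ)) rank₁
        where
        !uva : Unique (u ∷ v ∷ a ∷ [])
        !uva = (u≢v ∷ (u∉p ∘ here) ∷ []) ∷ ((v∉p ∘ here) ∷ []) ∷ [] ∷ []
      rank₃ : Adj G a b → CycleRank≥ G (q ʳ++ (w ∷ʳ b) ʳ++ L₁) 3
      rank₃ a~b = CycleRank≥-ear q q≢[] (∈-ʳ++⁺ʳ (w ∷ʳ b) u∈L₁) (∈-ʳ++⁺ʳ (w ∷ʳ b) v∈L₁) u≢v path₂ !q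
        (Disjoint-ʳ++⁺ʳ q#w
          (Disjoint-ʳ++⁺ʳ (Disjoint.sym (Disjoint-++⁺ˡ p#q (Disjoint-[-]ˡ v∉q))) (Disjoint-∷⁺ʳ u∉q Disjoint-[]ʳ)))
        (rank₂ a~b)

    first-end-nonadjacent : ∀ {q₁ q₂ q w} → Theta G u v [] (q₁ ∷ q₂ ∷ q) w → w ≢ [] → adj G q₁ v ≡ false
    first-end-nonadjacent {q₁} {q₂} {q} {w} θ w≢[] = ¬-not λ q₁~v →
      bicyclic⇒¬CycleRank≥3 bicyclic (∈-ʳ++⁺ʳ (q₂ ∷ q) (there u∈L₁)) (rank₃ q₁~v)
      where
      open Theta θ
      open Distinct distinct
      L₁ = w ʳ++ v ∷ u ∷ []
      u∈L₁ : u ∈ L₁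
      u∈L₁ = ∈-ʳ++⁺ʳ w (there (here refl))
      v∈L₁ : v ∈ L₁
      v∈L₁ = ∈-ʳ++⁺ʳ w (here refl)
      rank₁ : CycleRank≥ G L₁ 1
      rank₁ = CycleRank≥-ear w w≢[] (there (here refl)) (here refl) u≢v path₃ !w
        (Disjoint-∷⁺ʳ v∉w (Disjoint-∷⁺ʳ u∉w Disjoint-[]ʳ)) (CycleRank≥-edge (proj₁ path₁) u≢v)
      rank₂ : Adj G q₁ v → CycleRank≥ G (q₁ ∷ L₁) 2
      rank₂ q₁~v = CycleRank≥-path [] q₁ (u∈L₁ ∷ v∈L₁ ∷ []) ((u≢v ∷ []) ∷ [] ∷ []) (proj₁ path₂ , tt) (q₁~v ∷ [])
        ([] ∷ []) (Disjoint-ʳ++⁺ʳ (Disjoint-[-]ˡ (λ q₁∈w → q#w (here refl , q₁∈w)))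
                   (Disjoint-∷⁺ʳ (∉-∷ (v∉q ∘ here) λ ()) (Disjoint-∷⁺ʳ (∉-∷ (u∉q ∘ here) λ ()) Disjoint-[]ʳ)))
        rank₁
      rank₃ : Adj G q₁ v → CycleRank≥ G ((q₂ ∷ q) ʳ++ q₁ ∷ L₁) 3
      rank₃ q₁~v = CycleRank≥-ear (q₂ ∷ q) (λ ()) (here refl) (there v∈L₁) (v∉q ∘ here ∘ sym) (proj₂ path₂)
        (drop⁺ 1 !q)
        (Disjoint-∷⁺ʳ (Unique[x∷xs]⇒x∉xs !q) (Disjoint-ʳ++⁺ʳ (λ (x∈ , x∈w) → q#w (there x∈ , x∈w))
          (Disjoint-∷⁺ʳ (v∉q ∘ there) (Disjoint-∷⁺ʳ (u∉q ∘ there) Disjoint-[]ʳ))))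
        (rank₂ q₁~v)

    second-last-nonadjacent : ∀ {q₁ q₂ q w b} → Theta G u v [] (q₁ ∷ q₂ ∷ q) (w ∷ʳ b) → adj G q₂ b ≡ false
    second-last-nonadjacent {q₁} {q₂} {q} {w} {b} θ = ¬-not λ q₂~b →
      bicyclic⇒¬CycleRank≥3 bicyclic (∈-ʳ++⁺ʳ (w ∷ʳ b) u∈L₁) (rank₃ q₂~b)
      where
      open Theta θ
      open Distinct distinct
      qs = q₁ ∷ q₂ ∷ q
      L₁ = qs ʳ++ v ∷ u ∷ []
      u∈L₁ : u ∈ L₁
      u∈L₁ = ∈-ʳ++⁺ʳ qs (there (here refl))
      v∈L₁ : v ∈ L₁
      v∈L₁ = ∈-ʳ++⁺ʳ qs (here refl)
      q₂∈L₁ : q₂ ∈ L₁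
      q₂∈L₁ = ∈-ʳ++⁺ˡ qs (there (here refl))
      rank₁ : CycleRank≥ G L₁ 1
      rank₁ = CycleRank≥-ear qs (λ ()) (there (here refl)) (here refl) u≢v path₂ !q
        (Disjoint-∷⁺ʳ v∉q (Disjoint-∷⁺ʳ u∉q Disjoint-[]ʳ)) (CycleRank≥-edge (proj₁ path₁) u≢v)
      rank₃ : Adj G q₂ b → CycleRank≥ G ((w ∷ʳ b) ʳ++ L₁) 3
      rank₃ q₂~b = let path′ , b~v = ConsecAdj-∷ʳ⁻ G (u ∷ w) path₃ in
        CycleRank≥-path w b (u∈L₁ ∷ v∈L₁ ∷ q₂∈L₁ ∷ []) !uvq₂ path′ (b~v ∷ trans (adj-sym G b q₂) q₂~b ∷ []) !w
          (Disjoint-ʳ++⁺ʳ (Disjoint.sym q#w) (Disjoint-∷⁺ʳ v∉w (Disjoint-∷⁺ʳ u∉w Disjoint-[]ʳ))) rank₁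
        where
        !uvq₂ : Unique (u ∷ v ∷ q₂ ∷ [])
        !uvq₂ = (u≢v ∷ (u∉q ∘ there ∘ here) ∷ []) ∷ ((v∉q ∘ there ∘ here) ∷ []) ∷ [] ∷ []

  -- The 2-switch

  record Switchable (G : Graph n) (a b c d : Fin n) : Set where
    field
      a~b : Adj G a b
      c~d : Adj G c d
      a≁c : adj G a c ≡ false
      b≁d : adj G b d ≡ false
      a≢c : a ≢ c
      b≢d : b ≢ d

  select : Bool → Bool → Bool → Bool
  select removed added old = if removed then false else if added then true else old

  𝟙-select : ∀ r s o → (r ≡ true → o ≡ true) → (s ≡ true → o ≡ false) → 𝟙 (select r s o) + 𝟙 r ≡ 𝟙 o + 𝟙 s
  𝟙-select true  true  _     r⇒o s⇒¬o = case trans (sym (r⇒o refl)) (s⇒¬o refl) of λ ()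
  𝟙-select true  false true  _   _    = refl
  𝟙-select true  false false r⇒o _    = case r⇒o refl of λ ()
  𝟙-select false true  true  _   s⇒¬o = case s⇒¬o refl of λ ()
  𝟙-select false true  false _   _    = refl
  𝟙-select false false _     _   _    = refl

  module TwoSwitch {G : Graph n} {a b c d : Fin n} (sw : Switchable G a b c d) where
    open Switchable sw

    a≢b : a ≢ b
    a≢b refl = case trans (sym a~b) (adj-irr G a) of λ ()

    c≢d : c ≢ d
    c≢d refl = case trans (sym c~d) (adj-irr G c) of λ ()

    a≢d : a ≢ d
    a≢d refl = case trans (sym c~d) (trans (adj-sym G c a) a≁c) of λ ()

    b≢c : b ≢ c
    b≢c refl = case trans (sym c~d) b≁d of λ ()

    removed? : (i j : Fin n) → Dec (SameEdge i j a b ⊎ SameEdge i j c d)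
    removed? i j = sameEdge? i j a b ⊎-dec sameEdge? i j c d

    added? : (i j : Fin n) → Dec (SameEdge i j a c ⊎ SameEdge i j b d)
    added? i j = sameEdge? i j a c ⊎-dec sameEdge? i j b d

    switched-adj : Fin n → Fin n → Bool
    switched-adj i j = select (does (removed? i j)) (does (added? i j)) (adj G i j)

    private
      either-edge-flip : ∀ {x y x′ y′ : Fin n} (i j : Fin n) →
        does (sameEdge? i j x y ⊎-dec sameEdge? i j x′ y′) ≡ does (sameEdge? j i x y ⊎-dec sameEdge? j i x′ y′)
      either-edge-flip {x} {y} {x′} {y′} i j =
        does-⇔ (mk⇔ (Data.Sum.map SameEdge-sym SameEdge-sym) (Data.Sum.map SameEdge-sym SameEdge-sym))
          (sameEdge? i j x y ⊎-dec sameEdge? i j x′ y′) (sameEdge? j i x y ⊎-dec sameEdge? j i x′ y′)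

    switched-adj-sym : ∀ i j → switched-adj i j ≡ switched-adj j i
    switched-adj-sym i j = trans
      (cong₂ (λ r s → select r s (adj G i j)) (either-edge-flip i j) (either-edge-flip i j))
      (cong (select (does (removed? j i)) (does (added? j i))) (adj-sym G i j))

    switched-adj-irr : ∀ i → switched-adj i i ≡ false
    switched-adj-irr i = trans
      (cong₂ (select (does (removed? i i))) (dec-false (added? i i) (either (a≢c ∘ SameEdge-loop) (b≢d ∘ SameEdge-loop)))
                                            (adj-irr G i))
      (select-false (does (removed? i i)))
      where
      select-false : ∀ r → select r false false ≡ false
      select-false true  = refl
      select-false false = refl

    switched : Graph n
    switched = record { adj = switched-adj ; adj-sym = switched-adj-sym ; adj-irr = switched-adj-irr }

    switched-deg : ∀ i → deg switched i ≡ deg G i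
    switched-deg i = +-cancelʳ-≡ (∑ removed) (deg switched i) (deg G i) (begin
      deg switched i + ∑ removed                     ≡⟨ cong (_+ ∑ removed) (deg≡∑ switched i) ⟩
      ∑ (𝟙 ∘ switched-adj i) + ∑ removed             ≡⟨ ∑-distrib-+ (𝟙 ∘ switched-adj i) removed ⟨
      ∑[ j < n ] (𝟙 (switched-adj i j) + removed j)
        ≡⟨ sum-cong-≗ (λ j → 𝟙-select _ _ (adj G i j) (removed⇒adj j) (added⇒¬adj j)) ⟩
      ∑[ j < n ] (𝟙 (adj G i j) + added j)           ≡⟨ ∑-distrib-+ (𝟙 ∘ adj G i) added ⟩
      ∑ (𝟙 ∘ adj G i) + ∑ added                      ≡⟨ cong₂ _+_ (deg≡∑ G i) ∑removed≡∑added ⟨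
      deg G i + ∑ removed                            ∎)
      where
      open ≡-Reasoning
      ∑ : (Fin n → ℕ) → ℕ
      ∑ f = ∑[ j < n ] f j
      removed added : Fin n → ℕ
      removed j = 𝟙 (does (removed? i j))
      added   j = 𝟙 (does (added? i j))
      edge : Fin n → Fin n → Fin n → ℕ
      edge x y j = 𝟙 (does (sameEdge? i j x y))
      removed⇒adj : ∀ j → does (removed? i j) ≡ true → adj G i j ≡ true
      removed⇒adj j r = either (λ e → trans (adj-SameEdge G e) a~b) (λ e → trans (adj-SameEdge G e) c~d)
                               (does-true⇒ (removed? i j) r)
      added⇒¬adj : ∀ j → does (added? i j) ≡ true → adj G i j ≡ false
      added⇒¬adj j s = either (λ e → trans (adj-SameEdge G e) a≁c) (λ e → trans (adj-SameEdge G e) b≁d)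
                              (does-true⇒ (added? i j) s)
      ∑-removed : ∑ removed ≡ (δ a i + δ b i) + (δ c i + δ d i)
      ∑-removed = trans (sum-cong-≗ (λ j → 𝟙-⊎-dec (λ (e , e′) → either a≢c a≢d (SameEdge-shared e e′))
                                                  (sameEdge? i j a b) (sameEdge? i j c d)))
                 (trans (∑-distrib-+ (edge a b) (edge c d)) (cong₂ _+_ (∑-sameEdge a≢b i) (∑-sameEdge c≢d i)))
      ∑-added : ∑ added ≡ (δ a i + δ c i) + (δ b i + δ d i)
      ∑-added = trans (sum-cong-≗ (λ j → 𝟙-⊎-dec (λ (e , e′) → either a≢b a≢d (SameEdge-shared e e′))
                                                (sameEdge? i j a c) (sameEdge? i j b d)))
               (trans (∑-distrib-+ (edge a c) (edge b d)) (cong₂ _+_ (∑-sameEdge a≢c i) (∑-sameEdge b≢d i)))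
      ∑removed≡∑added : ∑ removed ≡ ∑ added
      ∑removed≡∑added = trans ∑-removed (trans (regroup (δ a i) (δ b i) (δ c i) (δ d i)) (sym ∑-added))
        where
        regroup : ∀ a b c d → (a + b) + (c + d) ≡ (a + c) + (b + d)
        regroup = solve-∀

    unchanged : ∀ {x y} → ¬ SameEdge x y a b → ¬ SameEdge x y c d →
      switched-adj x y ≡ select false (does (added? x y)) (adj G x y)
    unchanged {x} {y} ¬ab ¬cd =
      cong (λ r → select r (does (added? x y)) (adj G x y)) (dec-false (removed? x y) (either ¬ab ¬cd))

    a~c : Adj switched a c
    a~c = trans (unchanged (either (a≢b ∘ sym) b≢c ∘ SameEdge-endʳ) (either (a≢d ∘ sym) (c≢d ∘ sym) ∘ SameEdge-endʳ))
                (cong (λ s → select false s (adj G a c)) (dec-true (added? a c) (inj₁ same)))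

    b~d : Adj switched b d
    b~d = trans (unchanged (either a≢b a≢d ∘ SameEdge-endˡ) (either (b≢c ∘ sym) c≢d ∘ SameEdge-endˡ))
                (cong (λ s → select false s (adj G b d)) (dec-true (added? b d) (inj₂ same)))

    switched-keeps : ∀ {x y} → Adj G x y → ¬ SameEdge x y a b → ¬ SameEdge x y c d → Adj switched x y
    switched-keeps {x} {y} x~y ¬ab ¬cd = trans (unchanged ¬ab ¬cd) (keep (does (added? x y)) x~y)
      where
      keep : ∀ s {o} → o ≡ true → select false s o ≡ true
      keep true  _    = refl
      keep false refl = refl

    ConsecAdj-switched : ∀ L → ConsecAdj G L → ¬ (a ∈ L × b ∈ L) → ¬ (c ∈ L × d ∈ L) → ConsecAdj switched L
    ConsecAdj-switched []          _            _   _   = tt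
    ConsecAdj-switched (x ∷ [])    _            _   _   = tt
    ConsecAdj-switched (x ∷ y ∷ L) (x~y , path) ¬ab ¬cd =
      switched-keeps x~y (¬ab ∘ ends∈) (¬cd ∘ ends∈) ,
      ConsecAdj-switched (y ∷ L) path (¬ab ∘ Data.Product.map there there) (¬cd ∘ Data.Product.map there there)
      where
      ends∈ : ∀ {s t} → SameEdge x y s t → s ∈ x ∷ y ∷ L × t ∈ x ∷ y ∷ L
      ends∈ e = endpoint (SameEdge-endˡ e) , endpoint (SameEdge-endʳ e)
        where
        endpoint : ∀ {z} → z ≡ x ⊎ z ≡ y → z ∈ x ∷ y ∷ L
        endpoint (inj₁ z≡x) = here z≡x
        endpoint (inj₂ z≡y) = there (here z≡y)

-- Rerouting the theta by 2-switches

module _ {n : ℕ} {D : Vec ℕ n} (bicyclic : ∀ G → IsRealization G D → Bicyclic G) where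

  ThetaRealization : Fin n → Fin n → List (Fin n) → List (Fin n) → List (Fin n) → Set
  ThetaRealization u v p q w = Σ (Graph n) λ G → IsRealization G D × Theta G u v p q w

  module _ {G : Graph n} (realizes : IsRealization G D) {u v : Fin n} where

    merge-first : ∀ {a p q w b} → Theta G u v (a ∷ p) q (w ∷ʳ b) → q ≢ [] →
      ThetaRealization u v [] q ((w ∷ʳ b) ++ a ∷ p)
    merge-first {a} {p} {q} {w} {b} θ q≢[] = switched , (λ i → trans (switched-deg i) (realizes i)) , record
      { path₁    = a~c , tt
      ; path₂    = ConsecAdj-switched (u ∷ q ++ [ v ]) path₂ (a∉uqv ∘ proj₂) (b∉uqv ∘ proj₂)
      ; path₃    = ConsecAdj-bridge switched w b a p
                     (ConsecAdj-switched (u ∷ w ∷ʳ b) (proj₁ split₃) (a∉uw ∘ proj₂) (v∉uw ∘ proj₁))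
                     (trans (switched-adj-sym b a) b~d)
                     (ConsecAdj-switched (a ∷ p ∷ʳ v) (proj₂ path₁) (u∉apv ∘ proj₁) (b∉apv ∘ proj₂))
      ; distinct = Distinct-merge distinct
      }
      where
      open Theta θ
      open Distinct distinct
      split₃ = ConsecAdj-∷ʳ⁻ G (u ∷ w) path₃
      b∈w : b ∈ w ∷ʳ b
      b∈w = ∈-++⁺ʳ w (here refl)
      a∉w : a ∉ w ∷ʳ b
      a∉w a∈w = p#w (here refl , a∈w)
      a∉uqv : a ∉ u ∷ q ++ [ v ]
      a∉uqv = ∉-∷ (u∉p ∘ here ∘ sym) (∉-++ (λ a∈q → p#q (here refl , a∈q)) (∉-∷ (v∉p ∘ here ∘ sym) λ ()))
      b∉uqv : b ∉ u ∷ q ++ [ v ]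
      b∉uqv = ∉-∷ (λ { refl → u∉w b∈w }) (∉-++ (λ b∈q → q#w (b∈q , b∈w)) (∉-∷ (λ { refl → v∉w b∈w }) λ ()))
      a∉uw : a ∉ u ∷ w ∷ʳ b
      a∉uw = ∉-∷ (u∉p ∘ here ∘ sym) a∉w
      v∉uw : v ∉ u ∷ w ∷ʳ b
      v∉uw = ∉-∷ (u≢v ∘ sym) v∉w
      u∉apv : u ∉ a ∷ p ∷ʳ v
      u∉apv = ∉-++ u∉p (∉-∷ u≢v λ ())
      b∉apv : b ∉ a ∷ p ∷ʳ v
      b∉apv = ∉-++ (λ b∈p → p#w (b∈p , b∈w)) (∉-∷ (λ { refl → v∉w b∈w }) λ ())
      sw : Switchable G u a v b
      sw = record
        { a~b = proj₁ path₁
        ; c~d = trans (adj-sym G v b) (proj₂ split₃)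
        ; a≁c = ends-nonadjacent (bicyclic G realizes) θ (λ ()) q≢[] (∷ʳ≢[] w)
        ; b≁d = first-last-nonadjacent (bicyclic G realizes) θ q≢[]
        ; a≢c = u≢v
        ; b≢d = λ { refl → a∉w b∈w }
        }
      open TwoSwitch sw

    detach-second : ∀ {q₁ q₂ q w b} → Theta G u v [] (q₁ ∷ q₂ ∷ q) (w ∷ʳ b) →
      ThetaRealization u v [] (q₁ ∷ []) ((w ∷ʳ b) ++ q₂ ∷ q)
    detach-second {q₁} {q₂} {q} {w} {b} θ = switched , (λ i → trans (switched-deg i) (realizes i)) , record
      { path₁    = ConsecAdj-switched (u ∷ v ∷ []) path₁ (q₁∉uv ∘ proj₁) (b∉uv ∘ proj₂)
      ; path₂    = proj₁ (ConsecAdj-switched (u ∷ q₁ ∷ []) (proj₁ path₂ , tt) (q₂∉uq₁ ∘ proj₂) (v∉uq₁ ∘ proj₁)) , a~c , tt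
      ; path₃    = ConsecAdj-bridge switched w b q₂ q
                     (ConsecAdj-switched (u ∷ w ∷ʳ b) (proj₁ split₃) (q₁∉uw ∘ proj₁) (v∉uw ∘ proj₁))
                     (trans (switched-adj-sym b q₂) b~d)
                     (ConsecAdj-switched (q₂ ∷ q ∷ʳ v) (proj₂ (proj₂ path₂)) (q₁∉q₂qv ∘ proj₁) (b∉q₂qv ∘ proj₂))
      ; distinct = Distinct-merge (Distinct-detach distinct)
      }
      where
      open Theta θ
      open Distinct distinct
      split₃ = ConsecAdj-∷ʳ⁻ G (u ∷ w) path₃
      b∈w : b ∈ w ∷ʳ b
      b∈w = ∈-++⁺ʳ w (here refl)
      q₁∉q₂q : q₁ ∉ q₂ ∷ q
      q₁∉q₂q = Unique[x∷xs]⇒x∉xs !q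
      q₁∉uv : q₁ ∉ u ∷ v ∷ []
      q₁∉uv = ∉-∷ (u∉q ∘ here ∘ sym) (∉-∷ (v∉q ∘ here ∘ sym) λ ())
      b∉uv : b ∉ u ∷ v ∷ []
      b∉uv = ∉-∷ (λ { refl → u∉w b∈w }) (∉-∷ (λ { refl → v∉w b∈w }) λ ())
      q₂∉uq₁ : q₂ ∉ u ∷ q₁ ∷ []
      q₂∉uq₁ = ∉-∷ (u∉q ∘ there ∘ here ∘ sym) (∉-∷ (q₁∉q₂q ∘ here ∘ sym) λ ())
      v∉uq₁ : v ∉ u ∷ q₁ ∷ []
      v∉uq₁ = ∉-∷ (u≢v ∘ sym) (∉-∷ (v∉q ∘ here) λ ())
      q₁∉uw : q₁ ∉ u ∷ w ∷ʳ b
      q₁∉uw = ∉-∷ (u∉q ∘ here ∘ sym) (λ q₁∈w → q#w (here refl , q₁∈w))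
      v∉uw : v ∉ u ∷ w ∷ʳ b
      v∉uw = ∉-∷ (u≢v ∘ sym) v∉w
      q₁∉q₂qv : q₁ ∉ q₂ ∷ q ∷ʳ v
      q₁∉q₂qv = ∉-++ q₁∉q₂q (∉-∷ (v∉q ∘ here ∘ sym) λ ())
      b∉q₂qv : b ∉ q₂ ∷ q ∷ʳ v
      b∉q₂qv = ∉-++ (λ b∈ → q#w (there b∈ , b∈w)) (∉-∷ (λ { refl → v∉w b∈w }) λ ())
      sw : Switchable G q₁ q₂ v b
      sw = record
        { a~b = proj₁ (proj₂ path₂)
        ; c~d = trans (adj-sym G v b) (proj₂ split₃)
        ; a≁c = first-end-nonadjacent (bicyclic G realizes) θ (∷ʳ≢[] w)
        ; b≁d = second-last-nonadjacent (bicyclic G realizes) θ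
        ; a≢c = v∉q ∘ here ∘ sym
        ; b≢d = λ { refl → q#w (there (here refl) , b∈w) }
        }
      open TwoSwitch sw

  Θ₁₂-Realization : Fin n → Fin n → ℕ → Set
  Θ₁₂-Realization u v m = ∃ λ x → ∃ λ w → ThetaRealization u v [] (x ∷ []) w × w ≢ [] × suc (length w) ≡ m

  normalise-from-edge : ∀ {u v q₁ q w} → ThetaRealization u v [] (q₁ ∷ q) w → w ≢ [] →
    Θ₁₂-Realization u v (suc (length q) + length w)
  normalise-from-edge {q₁ = q₁} {[]}     {w} Θ w≢[] = q₁ , w , Θ , w≢[] , refl
  normalise-from-edge {q₁ = q₁} {q₂ ∷ q} {w} (G , realizes , θ) w≢[] with initLast w
  ... | []       = ⊥-elim (w≢[] refl)
  ... | w′ ∷ʳ′ b = q₁ , (w′ ∷ʳ b) ++ q₂ ∷ q , detach-second realizes θ , ∷ʳ≢[] w′ ∘ ++-conicalˡ (w′ ∷ʳ b) _ ,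
    cong suc (trans (length-++ (w′ ∷ʳ b)) (+-comm (length (w′ ∷ʳ b)) (suc (length q))))

  normalise : ∀ {u v p q w} → ThetaRealization u v p q w →
    ¬ (p ≡ [] × q ≡ []) → ¬ (p ≡ [] × w ≡ []) → ¬ (q ≡ [] × w ≡ []) →
    Θ₁₂-Realization u v (length p + length q + length w)
  normalise {p = []}    {[]}    Θ ¬pq _ _ = ⊥-elim (¬pq (refl , refl))
  normalise {p = []}    {_ ∷ _} Θ _ ¬pw _ = normalise-from-edge Θ (¬pw ∘ (refl ,_))
  normalise {p = _ ∷ p} {[]} {w} (G , realizes , θ) _ _ ¬qw =
    subst (Θ₁₂-Realization _ _) (cong (_+ length w) (sym (+-identityʳ (suc (length p)))))
      (normalise-from-edge (G , realizes , Theta-swap θ) (¬qw ∘ (refl ,_)))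
  normalise {p = a ∷ p} {_ ∷ q} {w} (G , realizes , θ) _ _ _ with initLast w
  ... | []       = subst (Θ₁₂-Realization _ _) (sym (+-identityʳ _))
                     (normalise-from-edge (G , realizes , Theta-rotate θ) λ ())
  ... | w′ ∷ʳ′ b = subst (Θ₁₂-Realization _ _) lengths
                     (normalise-from-edge (merge-first realizes θ λ ()) (∷ʳ≢[] w′ ∘ ++-conicalˡ (w′ ∷ʳ b) _))
    where
    lengths : suc (length q) + length ((w′ ∷ʳ b) ++ a ∷ p) ≡ suc (length p) + suc (length q) + length (w′ ∷ʳ b)
    lengths = trans (cong (suc (length q) +_) (length-++ (w′ ∷ʳ b))) (regroup (length q) (length (w′ ∷ʳ b)) (length p))
      where
      regroup : ∀ q w p → suc q + (w + suc p) ≡ suc p + suc q + w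
      regroup = solve-∀

Theta⇒ContainsTheta : ∀ {n} {G : Graph n} {u v x w} → Theta G u v [] (x ∷ []) w → w ≢ [] →
  ContainsTheta G 1 2 (suc (length w))
Theta⇒ContainsTheta {w = []}    _ w≢[] = ⊥-elim (w≢[] refl)
Theta⇒ContainsTheta {G = G} {u} {v} {x} {w@(_ ∷ _)} θ _ =
  (s≤s z≤n , s≤s z≤n , s≤s z≤n , (λ { (_ , ()) }) , (λ { (_ , ()) }) , (λ { (() , _) })) ,
  u , v , Data.Vec.[] , x Data.Vec.∷ Data.Vec.[] , fromList w , path₁ , path₂ ,
  subst (λ L → ConsecAdj G (u ∷ L ++ [ v ])) (sym (toList∘fromList w)) path₃ ,
  subst (λ L → Unique (u ∷ v ∷ x ∷ L)) (sym (toList∘fromList w)) (Distinct⇒Unique distinct)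
  where open Theta θ

lemma4p3 : ∀ {n} (D : Vec ℕ n) → ForciblyBicyclic D →
    (G : Graph n) → IsRealization G D →
    (r s t : ℕ) → ContainsTheta G r s t →
    Σ (Graph n) λ G' → IsRealization G' D × ContainsTheta G' 1 2 (r + s + t ∸ 3)
lemma4p3 D _ G _ zero    s       t       ((() , _) , _)
lemma4p3 D _ G _ (suc r) zero    t       ((_ , () , _) , _)
lemma4p3 D _ G _ (suc r) (suc s) zero    ((_ , _ , () , _) , _)
lemma4p3 D (_ , bicyclic) G realizes (suc r) (suc s) (suc t)
         ((_ , _ , _ , ¬rs , ¬rt , ¬st) , u , v , p , q , w , path₁ , path₂ , path₃ , distinct)
  with normalise {D = D} bicyclic
         (G , realizes , record { path₁ = path₁ ; path₂ = path₂ ; path₃ = path₃ ; distinct = Unique⇒Distinct distinct })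
         (λ (p≡[] , q≡[]) → ¬rs (empty p p≡[] , empty q q≡[]))
         (λ (p≡[] , w≡[]) → ¬rt (empty p p≡[] , empty w w≡[]))
         (λ (q≡[] , w≡[]) → ¬st (empty q q≡[] , empty w w≡[]))
  where
  empty : ∀ {m} (xs : Vec (Fin _) m) → toList xs ≡ [] → suc m ≡ 1
  empty xs xs≡[] = cong suc (trans (sym (length-toList xs)) (cong length xs≡[]))
... | _ , w′ , (G′ , realizes′ , θ′) , w′≢[] , lengths =
  G′ , realizes′ , subst (ContainsTheta G′ 1 2) total (Theta⇒ContainsTheta θ′ w′≢[])
  where
  total : suc (length w′) ≡ suc r + suc s + suc t ∸ 3
  total = begin
    suc (length w′)                                            ≡⟨ lengths ⟩
    length (toList p) + length (toList q) + length (toList w)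
      ≡⟨ cong₂ _+_ (cong₂ _+_ (length-toList p) (length-toList q)) (length-toList w) ⟩
    r + s + t                                                  ≡⟨ cong (_∸ 3) (three-more r s t) ⟨
    suc r + suc s + suc t ∸ 3                                  ∎
    where
    open ≡-Reasoning
    three-more : ∀ r s t → suc r + suc s + suc t ≡ 3 + (r + s + t)
    three-more = solve-∀
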